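{- For every subsequence σ (possibly empty) of e w_l w_r c and every language Ψ among ⟨∨,*,0,1⟩, ⟨∨,∧,*,0,1⟩, ⟨∨,*,⁻(right),⁻(left),0,1⟩, ⟨∨,∧,*,⁻(right),⁻(left),0,1⟩ and the full language ⟨∨,∧,*,\,/,⁻(right),⁻(left),0,1⟩, the Gentzen system FL_σ[Ψ] is algebraizable, with the variety K_σ[Ψ] as its equivalent algebraic semantics. Here K_σ[Ψ] is, respectively, the variety of pointed semilattice σ-monoids, pointed lattice σ-monoids, pseudocomplemented semilattice σ-monoids, pseudocomplemented lattice σ-monoids, and FL_σ-algebras (pointed residuated lattices satisfying the σ-properties).
   Context: FL is the full Lambek sequent calculus, with sequents Γ ⇒ Δ where Γ is a finite sequence of formulas and Δ has at most one formula. It is given in the language ⟨∨,∧,*,\,/,⁻(right),⁻(left),0,1⟩, where φ⁻ denotes the right negation and ⁻φ the left negation. Its rules are (Axiom), (Cut) and left/right introduction rules for each connective. FL_σ adds the structural rules coded by σ: e = exchange, w_l = left weakening, w_r = right weakening (Γ⇒∅ / Γ⇒φ), c = left contraction. FL_σ[Ψ] is the Gentzen system defined by the calculus obtained from FL_σ by dropping the introduction rules for the connectives not in Ψ. Pointed sl-monoids (resp. ℓ-monoids) are algebras ⟨A,∨,*,0,1⟩ (resp. ⟨A,∨,∧,*,0,1⟩) where ∨ gives a semilattice (resp. ∨,∧ give a lattice), ⟨A,*,1⟩ is a monoid, * distributes over ∨ on both sides, and 0 is an arbitrary constant. Let x ≼ y abbreviate x∨y ≈ y. Pseudocomplemented versions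 add unary operations x⁻ and ⁻x such that, for all a, b: a*b ≤ 0 iff b ≤ a⁻ iff a ≤ ⁻b. FL-algebras are pointed residuated lattices, with a*b ≤ c iff b ≤ a\c iff a ≤ c/b, and with x⁻ = x\0 and ⁻x = 0/x. The σ-properties are: - e: x*y ≈ y*x; - w_l: x ≼ 1; - w_r: 0 ≼ x; - c: x ≼ x*x. Algebraizability means that FL_σ[Ψ] and the equational consequence relation of K_σ[Ψ] are equivalent Gentzen systems via translations τ from sequents to equations and ρ from equations to sequents. These translations are: - τ(φ_0,…,φ_{m-1} ⇒ φ) = {(φ_0*…*φ_{m-1}) ∨ φ ≈ φ}, where the empty product is 1; - τ(φ_0,…,φ_{m-1} ⇒ ∅) = {(φ_0*…*φ_{m-1}) ∨ 0 ≈ 0}, where the empty product is 1; - ρ(φ ≈ ψ) = {φ ⇒ ψ, ψ ⇒ φ}. -}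

module Defs where

open import Level using (0ℓ)
open import Data.Nat using (ℕ)
open import Data.Bool using (Bool; true; false; T)
open import Data.Unit using (⊤; tt)
open import Data.Empty using (⊥)
open import Data.List using (List; []; _∷_; _++_; [_]; _∷ʳ_)
open import Data.Maybe using (Maybe; just; nothing)
open import Data.Product using (Σ; _×_; _,_)
open import Relation.Binary using (Rel; IsEquivalence)
open import Relation.Binary.PropositionalEquality using (_≡_)

-- Structural parameters σ : a subsequence of  e w_l w_r c
-- (a subsequence is determined by which of the four letters occur).

record StructRules : Set where
  field
    e  : Bool
    wl : Bool
    wr : Bool
    c  : Bool
open StructRules public

data Lang : Set where
  sl   : Lang
  lat  : Lang
  psl  : Lang
  plat : Lang
  full : Lang

HasMeet : Lang → Set
HasMeet sl   = ⊥
HasMeet lat  = ⊤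
HasMeet psl  = ⊥
HasMeet plat = ⊤
HasMeet full = ⊤

HasNeg : Lang → Set
HasNeg sl   = ⊥
HasNeg lat  = ⊥
HasNeg psl  = ⊤
HasNeg plat = ⊤
HasNeg full = ⊤

HasRes : Lang → Set
HasRes full = ⊤
HasRes _    = ⊥

res⇒meet : ∀ {Ψ} → HasRes Ψ → HasMeet Ψ
res⇒meet {full} _ = tt

res⇒neg : ∀ {Ψ} → HasRes Ψ → HasNeg Ψ
res⇒neg {full} _ = tt

infixr 6 _∨ᶠ_
infixr 7 _*ᶠ_

data Fm (Ψ : Lang) : Set where
  var   : ℕ → Fm Ψ
  _∨ᶠ_  : Fm Ψ → Fm Ψ → Fm Ψ
  _*ᶠ_  : Fm Ψ → Fm Ψ → Fm Ψ
  0ᶠ    : Fm Ψ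
  1ᶠ    : Fm Ψ
  meet  : HasMeet Ψ → Fm Ψ → Fm Ψ → Fm Ψ
  rneg  : HasNeg Ψ → Fm Ψ → Fm Ψ
  lneg  : HasNeg Ψ → Fm Ψ → Fm Ψ
  under : HasRes Ψ → Fm Ψ → Fm Ψ → Fm Ψ   -- under p φ ψ = φ \ ψ
  over  : HasRes Ψ → Fm Ψ → Fm Ψ → Fm Ψ   -- over  p ψ φ = ψ / φ

Seq : Lang → Set
Seq Ψ = List (Fm Ψ) × Maybe (Fm Ψ)

data Der (σ : StructRules) (Ψ : Lang) (H : Seq Ψ → Set) : Seq Ψ → Set where
  hyp  : ∀ {s} → H s → Der σ Ψ H s
  ax   : ∀ {φ} → Der σ Ψ H ([ φ ] , just φ)
  cut  : ∀ {Γ Σ' Ξ φ Δ} → Der σ Ψ H (Γ , just φ) → Der σ Ψ H (Σ' ++ φ ∷ Ξ , Δ)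
       → Der σ Ψ H (Σ' ++ Γ ++ Ξ , Δ)
  ∨L   : ∀ {Σ' Ξ φ ψ Δ} → Der σ Ψ H (Σ' ++ φ ∷ Ξ , Δ) → Der σ Ψ H (Σ' ++ ψ ∷ Ξ , Δ)
       → Der σ Ψ H (Σ' ++ (φ ∨ᶠ ψ) ∷ Ξ , Δ)
  ∨R₁  : ∀ {Γ φ ψ} → Der σ Ψ H (Γ , just φ) → Der σ Ψ H (Γ , just (φ ∨ᶠ ψ))
  ∨R₂  : ∀ {Γ φ ψ} → Der σ Ψ H (Γ , just ψ) → Der σ Ψ H (Γ , just (φ ∨ᶠ ψ))
  ∧L₁  : ∀ {Σ' Ξ φ ψ Δ} (p : HasMeet Ψ) → Der σ Ψ H (Σ' ++ φ ∷ Ξ , Δ)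
       → Der σ Ψ H (Σ' ++ meet p φ ψ ∷ Ξ , Δ)
  ∧L₂  : ∀ {Σ' Ξ φ ψ Δ} (p : HasMeet Ψ) → Der σ Ψ H (Σ' ++ ψ ∷ Ξ , Δ)
       → Der σ Ψ H (Σ' ++ meet p φ ψ ∷ Ξ , Δ)
  ∧R   : ∀ {Γ φ ψ} (p : HasMeet Ψ) → Der σ Ψ H (Γ , just φ) → Der σ Ψ H (Γ , just ψ)
       → Der σ Ψ H (Γ , just (meet p φ ψ))
  *L   : ∀ {Σ' Ξ φ ψ Δ} → Der σ Ψ H (Σ' ++ φ ∷ ψ ∷ Ξ , Δ)
       → Der σ Ψ H (Σ' ++ (φ *ᶠ ψ) ∷ Ξ , Δ)
  *R   : ∀ {Γ Π φ ψ} → Der σ Ψ H (Γ , just φ) → Der σ Ψ H (Π , just ψ)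
       → Der σ Ψ H (Γ ++ Π , just (φ *ᶠ ψ))
  underL : ∀ {Γ Σ' Ξ φ ψ Δ} (p : HasRes Ψ) → Der σ Ψ H (Γ , just φ)
       → Der σ Ψ H (Σ' ++ ψ ∷ Ξ , Δ)
       → Der σ Ψ H (Σ' ++ Γ ++ under p φ ψ ∷ Ξ , Δ)
  underR : ∀ {Γ φ ψ} (p : HasRes Ψ) → Der σ Ψ H (φ ∷ Γ , just ψ)
       → Der σ Ψ H (Γ , just (under p φ ψ))
  overL : ∀ {Γ Σ' Ξ φ ψ Δ} (p : HasRes Ψ) → Der σ Ψ H (Γ , just φ)
       → Der σ Ψ H (Σ' ++ ψ ∷ Ξ , Δ)
       → Der σ Ψ H (Σ' ++ over p ψ φ ∷ Γ ++ Ξ , Δ)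
  overR : ∀ {Γ φ ψ} (p : HasRes Ψ) → Der σ Ψ H (Γ ∷ʳ φ , just ψ)
       → Der σ Ψ H (Γ , just (over p ψ φ))
  -- right negation φ⁻  (behaves as φ\0)
  ⁻ʳL  : ∀ {Γ φ} (p : HasNeg Ψ) → Der σ Ψ H (Γ , just φ)
       → Der σ Ψ H (Γ ∷ʳ rneg p φ , nothing)
  ⁻ʳR  : ∀ {Γ φ} (p : HasNeg Ψ) → Der σ Ψ H (φ ∷ Γ , nothing)
       → Der σ Ψ H (Γ , just (rneg p φ))
  -- left negation ⁻φ  (behaves as 0/φ)
  ⁻ˡL  : ∀ {Γ φ} (p : HasNeg Ψ) → Der σ Ψ H (Γ , just φ)
       → Der σ Ψ H (lneg p φ ∷ Γ , nothing)
  ⁻ˡR  : ∀ {Γ φ} (p : HasNeg Ψ) → Der σ Ψ H (Γ ∷ʳ φ , nothing)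
       → Der σ Ψ H (Γ , just (lneg p φ))
  0L   : Der σ Ψ H ([ 0ᶠ ] , nothing)
  0R   : ∀ {Γ} → Der σ Ψ H (Γ , nothing) → Der σ Ψ H (Γ , just 0ᶠ)
  1L   : ∀ {Σ' Ξ Δ} → Der σ Ψ H (Σ' ++ Ξ , Δ) → Der σ Ψ H (Σ' ++ 1ᶠ ∷ Ξ , Δ)
  1R   : Der σ Ψ H ([] , just 1ᶠ)
  exch : ∀ {Σ' Ξ φ ψ Δ} → T (e σ) → Der σ Ψ H (Σ' ++ φ ∷ ψ ∷ Ξ , Δ)
       → Der σ Ψ H (Σ' ++ ψ ∷ φ ∷ Ξ , Δ)
  weakL : ∀ {Σ' Ξ φ Δ} → T (wl σ) → Der σ Ψ H (Σ' ++ Ξ , Δ)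
       → Der σ Ψ H (Σ' ++ φ ∷ Ξ , Δ)
  weakR : ∀ {Γ φ} → T (wr σ) → Der σ Ψ H (Γ , nothing) → Der σ Ψ H (Γ , just φ)
  contr : ∀ {Σ' Ξ φ Δ} → T (c σ) → Der σ Ψ H (Σ' ++ φ ∷ φ ∷ Ξ , Δ)
       → Der σ Ψ H (Σ' ++ φ ∷ Ξ , Δ)

record Alg (Ψ : Lang) : Set₁ where
  infixr 6 _∨_
  infixr 7 _*_
  infix 4 _≈_
  field
    Carrier : Set
    _≈_     : Rel Carrier 0ℓ
    isEquiv : IsEquivalence _≈_
    _∨_     : Carrier → Carrier → Carrier
    _*_     : Carrier → Carrier → Carrier
    𝟘 𝟙     : Carrier
    ∧op     : HasMeet Ψ → Carrier → Carrier → Carrier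
    rnegop  : HasNeg Ψ → Carrier → Carrier
    lnegop  : HasNeg Ψ → Carrier → Carrier
    underop     : HasRes Ψ → Carrier → Carrier → Carrier
    overop     : HasRes Ψ → Carrier → Carrier → Carrier
    ∨-cong  : ∀ {x x' y y'} → x ≈ x' → y ≈ y' → (x ∨ y) ≈ (x' ∨ y')
    *-cong  : ∀ {x x' y y'} → x ≈ x' → y ≈ y' → (x * y) ≈ (x' * y')
    ∧-cong  : ∀ p {x x' y y'} → x ≈ x' → y ≈ y' → ∧op p x y ≈ ∧op p x' y'
    rneg-cong : ∀ p {x x'} → x ≈ x' → rnegop p x ≈ rnegop p x'
    lneg-cong : ∀ p {x x'} → x ≈ x' → lnegop p x ≈ lnegop p x'
    under-cong  : ∀ p {x x' y y'} → x ≈ x' → y ≈ y' → underop p x y ≈ underop p x' y'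
    over-cong  : ∀ p {x x' y y'} → x ≈ x' → y ≈ y' → overop p x y ≈ overop p x' y'

  _≼_ : Carrier → Carrier → Set
  x ≼ y = (x ∨ y) ≈ y

record IsK (σ : StructRules) (Ψ : Lang) (A : Alg Ψ) : Set where
  open Alg A
  field
    ∨-assoc : ∀ x y z → ((x ∨ y) ∨ z) ≈ (x ∨ (y ∨ z))
    ∨-comm  : ∀ x y → (x ∨ y) ≈ (y ∨ x)
    ∨-idem  : ∀ x → (x ∨ x) ≈ x
    ∧-assoc : ∀ p x y z → ∧op p (∧op p x y) z ≈ ∧op p x (∧op p y z)
    ∧-comm  : ∀ p x y → ∧op p x y ≈ ∧op p y x
    ∧-idem  : ∀ p x → ∧op p x x ≈ x
    ∨-absorbs-∧ : ∀ p x y → (x ∨ ∧op p x y) ≈ x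
    ∧-absorbs-∨ : ∀ p x y → ∧op p x (x ∨ y) ≈ x
    *-assoc : ∀ x y z → ((x * y) * z) ≈ (x * (y * z))
    *-identityˡ : ∀ x → (𝟙 * x) ≈ x
    *-identityʳ : ∀ x → (x * 𝟙) ≈ x
    *-distribˡ-∨ : ∀ x y z → (x * (y ∨ z)) ≈ ((x * y) ∨ (x * z))
    *-distribʳ-∨ : ∀ x y z → ((y ∨ z) * x) ≈ ((y * x) ∨ (z * x))
    pc₁ : ∀ p a b → (a * b) ≼ 𝟘 → b ≼ rnegop p a
    pc₂ : ∀ p a b → b ≼ rnegop p a → (a * b) ≼ 𝟘
    pc₃ : ∀ p a b → (a * b) ≼ 𝟘 → a ≼ lnegop p b
    pc₄ : ∀ p a b → a ≼ lnegop p b → (a * b) ≼ 𝟘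
    res₁ : ∀ p a b c → (a * b) ≼ c → b ≼ underop p a c
    res₂ : ∀ p a b c → b ≼ underop p a c → (a * b) ≼ c
    res₃ : ∀ p a b c → (a * b) ≼ c → a ≼ overop p c b
    res₄ : ∀ p a b c → a ≼ overop p c b → (a * b) ≼ c
    rneg-def : ∀ p x → rnegop (res⇒neg p) x ≈ underop p x 𝟘
    lneg-def : ∀ p x → lnegop (res⇒neg p) x ≈ overop p 𝟘 x
    prop-e  : T (e σ)  → ∀ x y → (x * y) ≈ (y * x)
    prop-wl : T (wl σ) → ∀ x → x ≼ 𝟙
    prop-wr : T (wr σ) → ∀ x → 𝟘 ≼ x
    prop-c  : T (c σ)  → ∀ x → x ≼ (x * x)

record Eqn (Ψ : Lang) : Set where
  constructor _≈ᵉ_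
  field
    lhs rhs : Fm Ψ

module _ {Ψ : Lang} (A : Alg Ψ) where
  open Alg A
  ⟦_⟧ : Fm Ψ → (ℕ → Carrier) → Carrier
  ⟦ var n ⟧ h       = h n
  ⟦ φ ∨ᶠ ψ ⟧ h      = ⟦ φ ⟧ h ∨ ⟦ ψ ⟧ h
  ⟦ φ *ᶠ ψ ⟧ h      = ⟦ φ ⟧ h * ⟦ ψ ⟧ h
  ⟦ 0ᶠ ⟧ h          = 𝟘
  ⟦ 1ᶠ ⟧ h          = 𝟙
  ⟦ meet p φ ψ ⟧ h  = ∧op p (⟦ φ ⟧ h) (⟦ ψ ⟧ h)
  ⟦ rneg p φ ⟧ h    = rnegop p (⟦ φ ⟧ h)
  ⟦ lneg p φ ⟧ h    = lnegop p (⟦ φ ⟧ h)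
  ⟦ under p φ ψ ⟧ h = underop p (⟦ φ ⟧ h) (⟦ ψ ⟧ h)
  ⟦ over p φ ψ ⟧ h  = overop p (⟦ φ ⟧ h) (⟦ ψ ⟧ h)

  Sat : (ℕ → Carrier) → Eqn Ψ → Set
  Sat h (φ ≈ᵉ ψ) = ⟦ φ ⟧ h ≈ ⟦ ψ ⟧ h

Conseq : (σ : StructRules) (Ψ : Lang) → (Eqn Ψ → Set) → Eqn Ψ → Set₁
Conseq σ Ψ Θ ε = (A : Alg Ψ) → IsK σ Ψ A → (h : ℕ → Alg.Carrier A)
               → (∀ δ → Θ δ → Sat A h δ) → Sat A h ε

prod : ∀ {Ψ} → List (Fm Ψ) → Fm Ψ
prod []           = 1ᶠ
prod (φ ∷ [])     = φ
prod (φ ∷ ψ ∷ Γ)  = φ *ᶠ prod (ψ ∷ Γ)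

τ : ∀ {Ψ} → Seq Ψ → Eqn Ψ
τ (Γ , just φ)  = (prod Γ ∨ᶠ φ) ≈ᵉ φ
τ (Γ , nothing) = (prod Γ ∨ᶠ 0ᶠ) ≈ᵉ 0ᶠ

τ[_] : ∀ {Ψ} → (Seq Ψ → Set) → Eqn Ψ → Set
τ[ H ] ε = Σ _ λ s → H s × (ε ≡ τ s)

ρ : ∀ {Ψ} → Eqn Ψ → Seq Ψ → Set
ρ (φ ≈ᵉ ψ) s = (s ≡ ([ φ ] , just ψ)) Data.Sum.⊎ (s ≡ ([ ψ ] , just φ))
  where import Data.Sum

ρ[_] : ∀ {Ψ} → (Eqn Ψ → Set) → Seq Ψ → Set
ρ[ Θ ] s = Σ _ λ ε → Θ ε × ρ ε s

⟨_⟩ : ∀ {Ψ} → Eqn Ψ → Eqn Ψ → Set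
⟨ ε ⟩ δ = δ ≡ ε

-- Algebraizability of FL_σ[Ψ] with equivalent algebraic semantics
-- K_σ[Ψ], via τ and ρ (Blok–Pigozzi / Rebagliato–Verdú style):
--  (i)  H ⊢ s   iff   τ[H] ⊨_K τ(s)
--  (ii) ε  =||=_K  τ[ρ(ε)]
Algebraizable : StructRules → Lang → Set₁
Algebraizable σ Ψ =
  (∀ (H : Seq Ψ → Set) (s : Seq Ψ) →
     (Der σ Ψ H s → Conseq σ Ψ τ[ H ] (τ s))
   × (Conseq σ Ψ τ[ H ] (τ s) → Der σ Ψ H s))
  × (∀ (ε : Eqn Ψ) →
       (∀ δ → τ[ ρ ε ] δ → Conseq σ Ψ ⟨ ε ⟩ δ)
     × Conseq σ Ψ τ[ ρ ε ] ε)

-- A sequent Γ ⇒ Δ holds in an algebra when the product of Γ lies below Δ (the empty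
-- succedent being read as 0); this is exactly what τ says. Every rule of FL_σ[Ψ] preserves
-- this inequality in the members of K_σ[Ψ], which gives soundness. Conversely, the formulas
-- modulo interderivability from H form a member of K_σ[Ψ] (the Lindenbaum algebra) in which
-- the valuation x ↦ x satisfies τ[H] and validates exactly the sequents derivable from H.
-- The equivalence of ε with τ[ρ(ε)] is antisymmetry of the semilattice order.
module Submission where

open import Defs
open import Data.Nat using (ℕ)
open import Data.List using (List; []; _∷_; _++_; [_]; _∷ʳ_)
open import Data.List.Properties using (++-assoc; ++-identityʳ)
open import Data.Maybe using (Maybe; just; nothing)
open import Data.Product using (_×_; _,_; proj₁)
open import Data.Sum using (inj₁; inj₂)
open import Relation.Binary using (IsEquivalence; IsPreorder)
import Relation.Binary.Reasoning.Base.Double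
open import Relation.Binary.PropositionalEquality
  using (_≡_; refl; sym; cong; cong₂; subst; subst₂)

succedent : ∀ {Ψ} → Maybe (Fm Ψ) → Fm Ψ
succedent (just φ) = φ
succedent nothing  = 0ᶠ

module Order {σ Ψ} (A : Alg Ψ) (K : IsK σ Ψ A) where
  open Alg A
  open IsK K
  open IsEquivalence isEquiv renaming (refl to ≈-refl; sym to ≈-sym; trans to ≈-trans)

  ≈⇒≼ : ∀ {x y} → x ≈ y → x ≼ y
  ≈⇒≼ {x} {y} x≈y = ≈-trans (∨-cong x≈y ≈-refl) (∨-idem y)

  ≼-refl : ∀ {x} → x ≼ x
  ≼-refl = ≈⇒≼ ≈-refl

  ≼-trans : ∀ {x y z} → x ≼ y → y ≼ z → x ≼ z
  ≼-trans {x} {y} {z} x≼y y≼z =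
    ≈-trans (∨-cong ≈-refl (≈-sym y≼z))
      (≈-trans (≈-sym (∨-assoc x y z)) (≈-trans (∨-cong x≼y ≈-refl) y≼z))

  ≼-antisym : ∀ {x y} → x ≼ y → y ≼ x → x ≈ y
  ≼-antisym {x} {y} x≼y y≼x = ≈-trans (≈-sym y≼x) (≈-trans (∨-comm y x) x≼y)

  ≼-isPreorder : IsPreorder _≈_ _≼_
  ≼-isPreorder = record { isEquivalence = isEquiv ; reflexive = ≈⇒≼ ; trans = ≼-trans }

  module ≼-Reasoning = Relation.Binary.Reasoning.Base.Double ≼-isPreorder

  x≼x∨y : ∀ {x y} → x ≼ (x ∨ y)
  x≼x∨y {x} {y} = ≈-trans (≈-sym (∨-assoc x x y)) (∨-cong (∨-idem x) ≈-refl)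

  y≼x∨y : ∀ {x y} → y ≼ (x ∨ y)
  y≼x∨y {x} {y} = ≼-trans x≼x∨y (≈⇒≼ (∨-comm y x))

  ∨-least : ∀ {x y z} → x ≼ z → y ≼ z → (x ∨ y) ≼ z
  ∨-least {x} {y} {z} x≼z y≼z = ≈-trans (∨-assoc x y z) (≈-trans (∨-cong ≈-refl y≼z) x≼z)

  *-monoˡ-≼ : ∀ {x y} z → x ≼ y → (x * z) ≼ (y * z)
  *-monoˡ-≼ {x} {y} z x≼y = ≈-trans (≈-sym (*-distribʳ-∨ z x y)) (*-cong x≼y ≈-refl)

  *-monoʳ-≼ : ∀ {x y} z → x ≼ y → (z * x) ≼ (z * y)
  *-monoʳ-≼ {x} {y} z x≼y = ≈-trans (≈-sym (*-distribˡ-∨ z x y)) (*-cong ≈-refl x≼y)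

  *-mono-≼ : ∀ {x x′ y y′} → x ≼ x′ → y ≼ y′ → (x * y) ≼ (x′ * y′)
  *-mono-≼ {x′ = x′} {y} x≼x′ y≼y′ = ≼-trans (*-monoˡ-≼ y x≼x′) (*-monoʳ-≼ x′ y≼y′)

  x∧y≼x : ∀ p {x y} → ∧op p x y ≼ x
  x∧y≼x p {x} {y} = ≈-trans (∨-comm _ _) (∨-absorbs-∧ p x y)

  x∧y≼y : ∀ p {x y} → ∧op p x y ≼ y
  x∧y≼y p {x} {y} = ≼-trans (≈⇒≼ (∧-comm p x y)) (x∧y≼x p)

  ∧-greatest : ∀ p {x y z} → z ≼ x → z ≼ y → z ≼ ∧op p x y
  ∧-greatest p {x} {y} {z} z≼x z≼y =
    ≈-trans (∨-cong (≈-sym z∧x∧y≈z) ≈-refl)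
      (≈-trans (∨-cong (∧-comm p z _) ≈-refl) (≈-trans (∨-comm _ _) (∨-absorbs-∧ p _ z)))
    where
      ≼⇒∧≈ : ∀ {u v} → u ≼ v → ∧op p u v ≈ u
      ≼⇒∧≈ {u} {v} u≼v = ≈-trans (∧-cong p ≈-refl (≈-sym u≼v)) (∧-absorbs-∨ p u v)

      z∧x∧y≈z : ∧op p z (∧op p x y) ≈ z
      z∧x∧y≈z = ≈-trans (≈-sym (∧-assoc p z x y))
                  (≈-trans (∧-cong p (≼⇒∧≈ z≼x) ≈-refl) (≼⇒∧≈ z≼y))

  x*x⁻≼0 : ∀ p x → (x * rnegop p x) ≼ 𝟘
  x*x⁻≼0 p x = pc₂ p x _ ≼-refl

  ⁻x*x≼0 : ∀ p x → (lnegop p x * x) ≼ 𝟘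
  ⁻x*x≼0 p x = pc₄ p _ x ≼-refl

  x*[x\y]≼y : ∀ p x y → (x * underop p x y) ≼ y
  x*[x\y]≼y p x y = res₂ p x _ y ≼-refl

  [y/x]*x≼y : ∀ p x y → (overop p y x * x) ≼ y
  [y/x]*x≼y p x y = res₄ p _ x y ≼-refl

module Interpretation {σ Ψ} (A : Alg Ψ) (K : IsK σ Ψ A) (h : ℕ → Alg.Carrier A) where
  open Alg A
  open IsK K
  open IsEquivalence isEquiv renaming (refl to ≈-refl; sym to ≈-sym; trans to ≈-trans; reflexive to ≡⇒≈)
  open Order A K

  ⟦_⟧ᶠ : Fm Ψ → Carrier
  ⟦ φ ⟧ᶠ = ⟦_⟧ A φ h

  -- Taking the context product to be ⟦ prod Γ ⟧ makes Valid agree with satisfaction of τ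
  -- by definition.
  ⟦_⟧ᶜ : List (Fm Ψ) → Carrier
  ⟦ Γ ⟧ᶜ = ⟦ prod Γ ⟧ᶠ

  Valid : Seq Ψ → Set
  Valid (Γ , Δ) = ⟦ Γ ⟧ᶜ ≼ ⟦ succedent Δ ⟧ᶠ

  Sat-τ⇒Valid : ∀ s → Sat A h (τ s) → Valid s
  Sat-τ⇒Valid (Γ , just φ) holds = holds
  Sat-τ⇒Valid (Γ , nothing) holds = holds

  Valid⇒Sat-τ : ∀ s → Valid s → Sat A h (τ s)
  Valid⇒Sat-τ (Γ , just φ) valid = valid
  Valid⇒Sat-τ (Γ , nothing) valid = valid

  ⟦++⟧ : ∀ Γ Π → ⟦ Γ ++ Π ⟧ᶜ ≈ (⟦ Γ ⟧ᶜ * ⟦ Π ⟧ᶜ)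
  ⟦++⟧ []            Π       = ≈-sym (*-identityˡ _)
  ⟦++⟧ (φ ∷ [])      []      = ≈-sym (*-identityʳ _)
  ⟦++⟧ (φ ∷ [])      (ψ ∷ Π) = ≈-refl
  ⟦++⟧ (φ ∷ ψ ∷ Γ)   Π       = ≈-trans (*-cong ≈-refl (⟦++⟧ (ψ ∷ Γ) Π)) (≈-sym (*-assoc _ _ _))

  plug : List (Fm Ψ) → Carrier → List (Fm Ψ) → Carrier
  plug Σ′ x Ξ = ⟦ Σ′ ⟧ᶜ * (x * ⟦ Ξ ⟧ᶜ)

  ⟦plug⟧ : ∀ Σ′ Γ Ξ → ⟦ Σ′ ++ Γ ++ Ξ ⟧ᶜ ≈ plug Σ′ ⟦ Γ ⟧ᶜ Ξ
  ⟦plug⟧ Σ′ Γ Ξ = ≈-trans (⟦++⟧ Σ′ (Γ ++ Ξ)) (*-cong ≈-refl (⟦++⟧ Γ Ξ))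

  plug-mono : ∀ Σ′ Ξ {x y} → x ≼ y → plug Σ′ x Ξ ≼ plug Σ′ y Ξ
  plug-mono Σ′ Ξ x≼y = *-monoʳ-≼ ⟦ Σ′ ⟧ᶜ (*-monoˡ-≼ ⟦ Ξ ⟧ᶜ x≼y)

  plug-∨ : ∀ Σ′ Ξ x y → plug Σ′ (x ∨ y) Ξ ≈ (plug Σ′ x Ξ ∨ plug Σ′ y Ξ)
  plug-∨ Σ′ Ξ x y = ≈-trans (*-cong ≈-refl (*-distribʳ-∨ _ x y)) (*-distribˡ-∨ _ _ _)

  open ≼-Reasoning

  ⟦⟧ᶜ-mono : ∀ Σ′ Γ Π Ξ → ⟦ Γ ⟧ᶜ ≼ ⟦ Π ⟧ᶜ → ⟦ Σ′ ++ Γ ++ Ξ ⟧ᶜ ≼ ⟦ Σ′ ++ Π ++ Ξ ⟧ᶜ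
  ⟦⟧ᶜ-mono Σ′ Γ Π Ξ Γ≼Π = begin
    ⟦ Σ′ ++ Γ ++ Ξ ⟧ᶜ  ≈⟨ ⟦plug⟧ Σ′ Γ Ξ ⟩
    plug Σ′ ⟦ Γ ⟧ᶜ Ξ   ≲⟨ plug-mono Σ′ Ξ Γ≼Π ⟩
    plug Σ′ ⟦ Π ⟧ᶜ Ξ   ≈⟨ ⟦plug⟧ Σ′ Π Ξ ⟨
    ⟦ Σ′ ++ Π ++ Ξ ⟧ᶜ  ∎

  ⟦⟧ᶜ-∨ : ∀ Σ′ φ ψ Ξ → ⟦ Σ′ ++ (φ ∨ᶠ ψ) ∷ Ξ ⟧ᶜ ≈ (⟦ Σ′ ++ φ ∷ Ξ ⟧ᶜ ∨ ⟦ Σ′ ++ ψ ∷ Ξ ⟧ᶜ)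
  ⟦⟧ᶜ-∨ Σ′ φ ψ Ξ = begin-equality
    ⟦ Σ′ ++ [ φ ∨ᶠ ψ ] ++ Ξ ⟧ᶜ               ≈⟨ ⟦plug⟧ Σ′ [ φ ∨ᶠ ψ ] Ξ ⟩
    plug Σ′ (⟦ φ ⟧ᶠ ∨ ⟦ ψ ⟧ᶠ) Ξ              ≈⟨ plug-∨ Σ′ Ξ _ _ ⟩
    plug Σ′ ⟦ φ ⟧ᶠ Ξ ∨ plug Σ′ ⟦ ψ ⟧ᶠ Ξ     ≈⟨ ∨-cong (⟦plug⟧ Σ′ [ φ ] Ξ) (⟦plug⟧ Σ′ [ ψ ] Ξ) ⟨
    ⟦ Σ′ ++ φ ∷ Ξ ⟧ᶜ ∨ ⟦ Σ′ ++ ψ ∷ Ξ ⟧ᶜ     ∎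

  ⟦∷⟧ : ∀ φ Γ → ⟦ φ ∷ Γ ⟧ᶜ ≈ (⟦ φ ⟧ᶠ * ⟦ Γ ⟧ᶜ)
  ⟦∷⟧ φ = ⟦++⟧ [ φ ]

  ⟦∷ʳ⟧ : ∀ Γ φ → ⟦ Γ ∷ʳ φ ⟧ᶜ ≈ (⟦ Γ ⟧ᶜ * ⟦ φ ⟧ᶠ)
  ⟦∷ʳ⟧ Γ φ = ⟦++⟧ Γ [ φ ]

  module _ {H : Seq Ψ → Set} (valid-H : ∀ {s} → H s → Valid s) where

    sound : ∀ {s} → Der σ Ψ H s → Valid s
    sound (hyp s∈H) = valid-H s∈H
    sound ax = ≼-refl
    sound (cut {Γ} {Σ′} {Ξ} d d′) = ≼-trans (⟦⟧ᶜ-mono Σ′ Γ [ _ ] Ξ (sound d)) (sound d′)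
    sound (∨L {Σ′} {Ξ} {φ} {ψ} d d′) =
      ≼-trans (≈⇒≼ (⟦⟧ᶜ-∨ Σ′ φ ψ Ξ)) (∨-least (sound d) (sound d′))
    sound (∨R₁ d) = ≼-trans (sound d) x≼x∨y
    sound (∨R₂ d) = ≼-trans (sound d) y≼x∨y
    sound (∧L₁ {Σ′} {Ξ} p d) = ≼-trans (⟦⟧ᶜ-mono Σ′ [ _ ] [ _ ] Ξ (x∧y≼x p)) (sound d)
    sound (∧L₂ {Σ′} {Ξ} p d) = ≼-trans (⟦⟧ᶜ-mono Σ′ [ _ ] [ _ ] Ξ (x∧y≼y p)) (sound d)
    sound (∧R p d d′) = ∧-greatest p (sound d) (sound d′)
    sound (*L {Σ′} {Ξ} {φ} {ψ} d) = ≼-trans (⟦⟧ᶜ-mono Σ′ [ _ ] (φ ∷ ψ ∷ []) Ξ ≼-refl) (sound d)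
    sound (*R {Γ} {Π} d d′) = ≼-trans (≈⇒≼ (⟦++⟧ Γ Π)) (*-mono-≼ (sound d) (sound d′))
    sound (underL {Γ} {Σ′} {Ξ} {φ} {ψ} p d d′) = ≼-trans (≈⇒≼ reassociate) (≼-trans
      (⟦⟧ᶜ-mono Σ′ (Γ ∷ʳ under p φ ψ) [ ψ ] Ξ
        (≼-trans (≈⇒≼ (⟦∷ʳ⟧ Γ _)) (≼-trans (*-monoˡ-≼ _ (sound d)) (x*[x\y]≼y p _ _))))
      (sound d′))
      where
        reassociate : ⟦ Σ′ ++ Γ ++ under p φ ψ ∷ Ξ ⟧ᶜ ≈ ⟦ Σ′ ++ (Γ ∷ʳ under p φ ψ) ++ Ξ ⟧ᶜ
        reassociate = ≡⇒≈ (cong (λ Γ′ → ⟦ Σ′ ++ Γ′ ⟧ᶜ) (sym (++-assoc Γ [ under p φ ψ ] Ξ)))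
    sound (underR {Γ} {φ} p d) = res₁ p _ _ _ (≼-trans (≈⇒≼ (≈-sym (⟦∷⟧ φ Γ))) (sound d))
    sound (overL {Γ} {Σ′} {Ξ} {φ} {ψ} p d d′) = ≼-trans
      (⟦⟧ᶜ-mono Σ′ (over p ψ φ ∷ Γ) [ ψ ] Ξ
        (≼-trans (≈⇒≼ (⟦∷⟧ _ Γ)) (≼-trans (*-monoʳ-≼ _ (sound d)) ([y/x]*x≼y p _ _))))
      (sound d′)
    sound (overR {Γ} {φ} p d) = res₃ p _ _ _ (≼-trans (≈⇒≼ (≈-sym (⟦∷ʳ⟧ Γ φ))) (sound d))
    sound (⁻ʳL {Γ} p d) =
      ≼-trans (≈⇒≼ (⟦∷ʳ⟧ Γ _)) (≼-trans (*-monoˡ-≼ _ (sound d)) (x*x⁻≼0 p _))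
    sound (⁻ʳR {Γ} {φ} p d) = pc₁ p _ _ (≼-trans (≈⇒≼ (≈-sym (⟦∷⟧ φ Γ))) (sound d))
    sound (⁻ˡL {Γ} p d) =
      ≼-trans (≈⇒≼ (⟦∷⟧ _ Γ)) (≼-trans (*-monoʳ-≼ _ (sound d)) (⁻x*x≼0 p _))
    sound (⁻ˡR {Γ} {φ} p d) = pc₃ p _ _ (≼-trans (≈⇒≼ (≈-sym (⟦∷ʳ⟧ Γ φ))) (sound d))
    sound 0L = ≼-refl
    sound (0R d) = sound d
    sound (1L {Σ′} {Ξ} d) = ≼-trans (⟦⟧ᶜ-mono Σ′ [ 1ᶠ ] [] Ξ ≼-refl) (sound d)
    sound 1R = ≼-refl
    sound (exch {Σ′} {Ξ} {φ} {ψ} t d) =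
      ≼-trans (⟦⟧ᶜ-mono Σ′ (ψ ∷ φ ∷ []) (φ ∷ ψ ∷ []) Ξ (≈⇒≼ (prop-e t _ _))) (sound d)
    sound (weakL {Σ′} {Ξ} t d) = ≼-trans (⟦⟧ᶜ-mono Σ′ [ _ ] [] Ξ (prop-wl t _)) (sound d)
    sound (weakR t d) = ≼-trans (sound d) (prop-wr t _)
    sound (contr {Σ′} {Ξ} {φ} t d) =
      ≼-trans (⟦⟧ᶜ-mono Σ′ [ φ ] (φ ∷ φ ∷ []) Ξ (prop-c t _)) (sound d)

soundness : ∀ {σ Ψ H} s → Der σ Ψ H s → Conseq σ Ψ τ[ H ] (τ s)
soundness s d A K h sat-τ[H] = Valid⇒Sat-τ s (sound valid-H d)
  where
    open Interpretation A K h
    valid-H : ∀ {s′} → _ → Valid s′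
    valid-H {s′} s′∈H = Sat-τ⇒Valid s′ (sat-τ[H] (τ s′) (s′ , s′∈H , refl))

module Lindenbaum (σ : StructRules) (Ψ : Lang) (H : Seq Ψ → Set) where

  D : Seq Ψ → Set
  D = Der σ Ψ H

  infix 4 _⊢_ _⊣⊢_

  _⊢_ : Fm Ψ → Fm Ψ → Set
  φ ⊢ ψ = D ([ φ ] , just ψ)

  _⊣⊢_ : Fm Ψ → Fm Ψ → Set
  φ ⊣⊢ ψ = (φ ⊢ ψ) × (ψ ⊢ φ)

  ⊢-trans : ∀ {φ ψ χ} → φ ⊢ ψ → ψ ⊢ χ → φ ⊢ χ
  ⊢-trans = cut {Σ' = []} {Ξ = []}

  ∨L′ : ∀ {φ ψ Δ} → D ([ φ ] , Δ) → D ([ ψ ] , Δ) → D ([ φ ∨ᶠ ψ ] , Δ)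
  ∨L′ = ∨L {Σ' = []} {Ξ = []}

  ∧L₁′ : ∀ {φ ψ Δ} p → D ([ φ ] , Δ) → D ([ meet p φ ψ ] , Δ)
  ∧L₁′ = ∧L₁ {Σ' = []} {Ξ = []}

  ∧L₂′ : ∀ {φ ψ Δ} p → D ([ ψ ] , Δ) → D ([ meet p φ ψ ] , Δ)
  ∧L₂′ = ∧L₂ {Σ' = []} {Ξ = []}

  *L′ : ∀ {φ ψ Δ} → D (φ ∷ ψ ∷ [] , Δ) → D ([ φ *ᶠ ψ ] , Δ)
  *L′ = *L {Σ' = []} {Ξ = []}

  *R′ : ∀ {φ ψ φ′ ψ′} → φ ⊢ φ′ → ψ ⊢ ψ′ → D (φ ∷ ψ ∷ [] , just (φ′ *ᶠ ψ′))
  *R′ = *R {Γ = [ _ ]}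

  ⊢⇒≼ : ∀ {φ ψ} → φ ⊢ ψ → (φ ∨ᶠ ψ) ⊣⊢ ψ
  ⊢⇒≼ φ⊢ψ = ∨L′ φ⊢ψ ax , ∨R₂ ax

  ≼⇒⊢ : ∀ {φ ψ} → (φ ∨ᶠ ψ) ⊣⊢ ψ → φ ⊢ ψ
  ≼⇒⊢ φ∨ψ⊣⊢ψ = ⊢-trans (∨R₁ ax) (proj₁ φ∨ψ⊣⊢ψ)

  cut-front : ∀ {Γ φ Δ} → D (Γ , just φ) → D ([ φ ] , Δ) → D (Γ , Δ)
  cut-front {Γ} {Δ = Δ} d d′ =
    subst (λ Γ′ → D (Γ′ , Δ)) (++-identityʳ Γ) (cut {Σ' = []} {Ξ = []} d d′)

  ⊢0⇒empty : ∀ {φ ψ} → (φ *ᶠ ψ) ⊢ 0ᶠ → D (φ ∷ ψ ∷ [] , nothing)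
  ⊢0⇒empty φ*ψ⊢0 = cut-front (cut-front (*R′ ax ax) φ*ψ⊢0) 0L

  algebra : Alg Ψ
  algebra = record
    { Carrier = Fm Ψ ; _≈_ = _⊣⊢_
    ; isEquiv = record
      { refl  = ax , ax
      ; sym   = λ (φ⊢ψ , ψ⊢φ) → ψ⊢φ , φ⊢ψ
      ; trans = λ (φ⊢ψ , ψ⊢φ) (ψ⊢χ , χ⊢ψ) → ⊢-trans φ⊢ψ ψ⊢χ , ⊢-trans χ⊢ψ ψ⊢φ }
    ; _∨_ = _∨ᶠ_ ; _*_ = _*ᶠ_ ; 𝟘 = 0ᶠ ; 𝟙 = 1ᶠ
    ; ∧op = meet ; rnegop = rneg ; lnegop = lneg ; underop = under ; overop = over
    ; ∨-cong = λ (a , a′) (b , b′) → ∨L′ (∨R₁ a) (∨R₂ b) , ∨L′ (∨R₁ a′) (∨R₂ b′)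
    ; *-cong = λ (a , a′) (b , b′) → *L′ (*R′ a b) , *L′ (*R′ a′ b′)
    ; ∧-cong = λ p (a , a′) (b , b′) → ∧R p (∧L₁′ p a) (∧L₂′ p b) , ∧R p (∧L₁′ p a′) (∧L₂′ p b′)
    ; rneg-cong = λ p (a , a′) →
        ⁻ʳR p (⁻ʳL {Γ = [ _ ]} p a′) , ⁻ʳR p (⁻ʳL {Γ = [ _ ]} p a)
    ; lneg-cong = λ p (a , a′) →
        ⁻ˡR p (⁻ˡL {Γ = [ _ ]} p a′) , ⁻ˡR p (⁻ˡL {Γ = [ _ ]} p a)
    ; under-cong = λ p (a , a′) (b , b′) →
        underR p (underL {Γ = [ _ ]} {Σ' = []} {Ξ = []} p a′ b)
      , underR p (underL {Γ = [ _ ]} {Σ' = []} {Ξ = []} p a b′)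
    ; over-cong = λ p (a , a′) (b , b′) →
        overR p (overL {Γ = [ _ ]} {Σ' = []} {Ξ = []} p b′ a)
      , overR p (overL {Γ = [ _ ]} {Σ' = []} {Ξ = []} p b a′)
    }

  algebra∈K : IsK σ Ψ algebra
  algebra∈K = record
    { ∨-assoc = λ _ _ _ → ∨L′ (∨L′ (∨R₁ ax) (∨R₂ (∨R₁ ax))) (∨R₂ (∨R₂ ax))
                        , ∨L′ (∨R₁ (∨R₁ ax)) (∨L′ (∨R₁ (∨R₂ ax)) (∨R₂ ax))
    ; ∨-comm = λ _ _ → ∨L′ (∨R₂ ax) (∨R₁ ax) , ∨L′ (∨R₂ ax) (∨R₁ ax)
    ; ∨-idem = λ _ → ∨L′ ax ax , ∨R₁ ax
    ; ∧-assoc = λ p _ _ _ →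
        ∧R p (∧L₁′ p (∧L₁′ p ax)) (∧R p (∧L₁′ p (∧L₂′ p ax)) (∧L₂′ p ax))
      , ∧R p (∧R p (∧L₁′ p ax) (∧L₂′ p (∧L₁′ p ax))) (∧L₂′ p (∧L₂′ p ax))
    ; ∧-comm = λ p _ _ → ∧R p (∧L₂′ p ax) (∧L₁′ p ax) , ∧R p (∧L₂′ p ax) (∧L₁′ p ax)
    ; ∧-idem = λ p _ → ∧L₁′ p ax , ∧R p ax ax
    ; ∨-absorbs-∧ = λ p _ _ → ∨L′ ax (∧L₁′ p ax) , ∨R₁ ax
    ; ∧-absorbs-∨ = λ p _ _ → ∧L₁′ p ax , ∧R p ax (∨R₁ ax)
    ; *-assoc = λ x _ z → *L′ (*L {Σ' = []} {Ξ = [ z ]} (*R {Γ = [ _ ]} ax (*R′ ax ax)))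
                        , *L′ (*L {Σ' = [ x ]} {Ξ = []} (*R {Γ = x ∷ _ ∷ []} (*R′ ax ax) ax))
    ; *-identityˡ = λ x → *L′ (1L {Σ' = []} {Ξ = [ x ]} ax) , *R {Γ = []} 1R ax
    ; *-identityʳ = λ x → *L′ (1L {Σ' = [ x ]} {Ξ = []} ax) , *R {Γ = [ x ]} ax 1R
    ; *-distribˡ-∨ = λ x _ _ →
        *L′ (∨L {Σ' = [ x ]} {Ξ = []} (∨R₁ (*R′ ax ax)) (∨R₂ (*R′ ax ax)))
      , ∨L′ (*L′ (*R′ ax (∨R₁ ax))) (*L′ (*R′ ax (∨R₂ ax)))
    ; *-distribʳ-∨ = λ x _ _ →
        *L′ (∨L {Σ' = []} {Ξ = [ x ]} (∨R₁ (*R′ ax ax)) (∨R₂ (*R′ ax ax)))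
      , ∨L′ (*L′ (*R′ (∨R₁ ax) ax)) (*L′ (*R′ (∨R₂ ax) ax))
    ; pc₁ = λ p _ _ ab≼0 → ⊢⇒≼ (⁻ʳR p (⊢0⇒empty (≼⇒⊢ ab≼0)))
    ; pc₂ = λ p a _ b≼a⁻ →
        ⊢⇒≼ (*L′ (0R (cut {Σ' = [ a ]} {Ξ = []} (≼⇒⊢ b≼a⁻) (⁻ʳL {Γ = [ a ]} p ax))))
    ; pc₃ = λ p _ _ ab≼0 → ⊢⇒≼ (⁻ˡR p (⊢0⇒empty (≼⇒⊢ ab≼0)))
    ; pc₄ = λ p _ b a≼⁻b →
        ⊢⇒≼ (*L′ (0R (cut {Σ' = []} {Ξ = [ b ]} (≼⇒⊢ a≼⁻b) (⁻ˡL {Γ = [ b ]} p ax))))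
    ; res₁ = λ p _ _ _ ab≼c → ⊢⇒≼ (underR p (cut {Σ' = []} {Ξ = []} (*R′ ax ax) (≼⇒⊢ ab≼c)))
    ; res₂ = λ p a _ _ b≼a\c → ⊢⇒≼ (*L′ (cut {Σ' = [ a ]} {Ξ = []} (≼⇒⊢ b≼a\c)
                                        (underL {Γ = [ a ]} {Σ' = []} {Ξ = []} p ax ax)))
    ; res₃ = λ p _ _ _ ab≼c → ⊢⇒≼ (overR p (cut {Σ' = []} {Ξ = []} (*R′ ax ax) (≼⇒⊢ ab≼c)))
    ; res₄ = λ p _ b _ a≼c/b → ⊢⇒≼ (*L′ (cut {Σ' = []} {Ξ = [ b ]} (≼⇒⊢ a≼c/b)
                                        (overL {Γ = [ b ]} {Σ' = []} {Ξ = []} p ax ax)))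
    ; rneg-def = λ p x →
        underR p (0R (⁻ʳL {Γ = [ x ]} (res⇒neg p) ax))
      , ⁻ʳR (res⇒neg p) (underL {Γ = [ x ]} {Σ' = []} {Ξ = []} p ax 0L)
    ; lneg-def = λ p x →
        overR p (0R (⁻ˡL {Γ = [ x ]} (res⇒neg p) ax))
      , ⁻ˡR (res⇒neg p) (overL {Γ = [ x ]} {Σ' = []} {Ξ = []} p ax 0L)
    ; prop-e = λ t _ _ → *L′ (exch {Σ' = []} {Ξ = []} t (*R′ ax ax))
                       , *L′ (exch {Σ' = []} {Ξ = []} t (*R′ ax ax))
    ; prop-wl = λ t _ → ⊢⇒≼ (weakL {Σ' = []} {Ξ = []} t 1R)
    ; prop-wr = λ t _ → ⊢⇒≼ (weakR t 0L)
    ; prop-c = λ t _ → ⊢⇒≼ (contr {Σ' = []} {Ξ = []} t (*R′ ax ax))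
    }

  ⟦_⟧-var : ∀ φ → ⟦_⟧ algebra φ var ≡ φ
  ⟦ var n ⟧-var       = refl
  ⟦ φ ∨ᶠ ψ ⟧-var      = cong₂ _∨ᶠ_ ⟦ φ ⟧-var ⟦ ψ ⟧-var
  ⟦ φ *ᶠ ψ ⟧-var      = cong₂ _*ᶠ_ ⟦ φ ⟧-var ⟦ ψ ⟧-var
  ⟦ 0ᶠ ⟧-var          = refl
  ⟦ 1ᶠ ⟧-var          = refl
  ⟦ meet p φ ψ ⟧-var  = cong₂ (meet p) ⟦ φ ⟧-var ⟦ ψ ⟧-var
  ⟦ rneg p φ ⟧-var    = cong (rneg p) ⟦ φ ⟧-var
  ⟦ lneg p φ ⟧-var    = cong (lneg p) ⟦ φ ⟧-var
  ⟦ under p φ ψ ⟧-var = cong₂ (under p) ⟦ φ ⟧-var ⟦ ψ ⟧-var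
  ⟦ over p φ ψ ⟧-var  = cong₂ (over p) ⟦ φ ⟧-var ⟦ ψ ⟧-var

  open Interpretation algebra algebra∈K var using (Valid; Valid⇒Sat-τ; Sat-τ⇒Valid)

  prod-R : ∀ Γ → D (Γ , just (prod Γ))
  prod-R []          = 1R
  prod-R (φ ∷ [])    = ax
  prod-R (φ ∷ ψ ∷ Γ) = *R {Γ = [ φ ]} ax (prod-R (ψ ∷ Γ))

  prod-L : ∀ Σ′ Γ Ξ {Δ} → D (Σ′ ++ Γ ++ Ξ , Δ) → D (Σ′ ++ prod Γ ∷ Ξ , Δ)
  prod-L Σ′ []          Ξ d = 1L {Σ' = Σ′} {Ξ = Ξ} d
  prod-L Σ′ (φ ∷ [])    Ξ d = d
  prod-L Σ′ (φ ∷ ψ ∷ Γ) Ξ {Δ} d =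
    *L {Σ' = Σ′} (reassoc (prod-L (Σ′ ∷ʳ φ) (ψ ∷ Γ) Ξ (reassoc⁻¹ d)))
    where
      reassoc : ∀ {Π} → D ((Σ′ ∷ʳ φ) ++ Π , Δ) → D (Σ′ ++ φ ∷ Π , Δ)
      reassoc {Π} = subst (λ Γ′ → D (Γ′ , Δ)) (++-assoc Σ′ [ φ ] Π)

      reassoc⁻¹ : ∀ {Π} → D (Σ′ ++ φ ∷ Π , Δ) → D ((Σ′ ∷ʳ φ) ++ Π , Δ)
      reassoc⁻¹ {Π} = subst (λ Γ′ → D (Γ′ , Δ)) (sym (++-assoc Σ′ [ φ ] Π))

  succedent-R : ∀ {Γ} Δ → D (Γ , Δ) → D (Γ , just (succedent Δ))
  succedent-R (just φ) d = d
  succedent-R nothing  d = 0R d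

  succedent-L : ∀ Δ → D ([ succedent Δ ] , Δ)
  succedent-L (just φ) = ax
  succedent-L nothing  = 0L

  Der⇒Valid : ∀ s → D s → Valid s
  Der⇒Valid (Γ , Δ) d =
    subst₂ (λ φ ψ → (φ ∨ᶠ ψ) ⊣⊢ ψ) (sym ⟦ prod Γ ⟧-var) (sym ⟦ succedent Δ ⟧-var)
      (⊢⇒≼ (prod-L [] Γ [] (subst (λ Γ′ → D (Γ′ , _)) (sym (++-identityʳ Γ)) (succedent-R Δ d))))

  Valid⇒Der : ∀ s → Valid s → D s
  Valid⇒Der (Γ , Δ) valid = cut-front (cut-front (prod-R Γ) prod-Γ⊢Δ) (succedent-L Δ)
    where
      prod-Γ⊢Δ : prod Γ ⊢ succedent Δ
      prod-Γ⊢Δ = ≼⇒⊢ (subst₂ (λ φ ψ → (φ ∨ᶠ ψ) ⊣⊢ ψ) ⟦ prod Γ ⟧-var ⟦ succedent Δ ⟧-var valid)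

  completeness : ∀ s → Conseq σ Ψ τ[ H ] (τ s) → D s
  completeness s τ[H]⊨τs = Valid⇒Der s (Sat-τ⇒Valid s (τ[H]⊨τs algebra algebra∈K var sat-τ[H]))
    where
      sat-τ[H] : ∀ δ → τ[ H ] δ → Sat algebra var δ
      sat-τ[H] _ (s′ , s′∈H , refl) = Valid⇒Sat-τ s′ (Der⇒Valid s′ (hyp s′∈H))

ε⊨τ[ρε] : ∀ {σ Ψ} (ε : Eqn Ψ) δ → τ[ ρ ε ] δ → Conseq σ Ψ ⟨ ε ⟩ δ
ε⊨τ[ρε] (φ ≈ᵉ ψ) _ (_ , inj₁ refl , refl) A K h sat-ε = Order.≈⇒≼ A K (sat-ε _ refl)
ε⊨τ[ρε] (φ ≈ᵉ ψ) _ (_ , inj₂ refl , refl) A K h sat-ε =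
  Order.≈⇒≼ A K (IsEquivalence.sym (Alg.isEquiv A) (sat-ε _ refl))

τ[ρε]⊨ε : ∀ {σ Ψ} (ε : Eqn Ψ) → Conseq σ Ψ τ[ ρ ε ] ε
τ[ρε]⊨ε (φ ≈ᵉ ψ) A K h sat-τρε =
  Order.≼-antisym A K (sat-τρε _ (_ , inj₁ refl , refl)) (sat-τρε _ (_ , inj₂ refl , refl))

theorem21 : ∀ (σ : StructRules) (Ψ : Lang) → Algebraizable σ Ψ
theorem21 σ Ψ = (λ H s → soundness s , Lindenbaum.completeness σ Ψ H s)
              , (λ ε → ε⊨τ[ρε] ε , τ[ρε]⊨ε ε)
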